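{- Let $\mathbf{Q}$ be Robinson arithmetic and let $\mathbf{Q}^\omega$ denote $\mathbf{Q}$ formalized in inferential $\omega$-logic, where the distinguished countable set of constants $\mathrm{Const}(\tau_N)$ names (via a valuation onto) the elements of the standard model $\mathbf N=\langle\mathbb N,0,S,+,\times\rangle$. Then the standard model of $\mathbf{Q}$ has no proper extension satisfying $\mathbf{Q}^\omega$ (i.e. no proper extension carries an admissible valuation), and hence $\mathbf{Q}^\omega$ is categorical (all its models are isomorphic).
   Context: Robinson's $\mathbf Q$ is the finitely axiomatized first-order theory in the vocabulary with constant $0$, unary function $S$ and binary functions $+,\times$, with axioms: $Sx\neq 0$; $Sx=Sy\to x=y$; $x\neq0\to\exists y\,(x=Sy)$; $x+0=x$; $x+Sy=S(x+y)$; $x\times0=0$; $x\times Sy=x\times y+x$. A valuation assigns truth values to sentences; it is permissible if it assigns values to all quantifier-free sentences, the sentences made true are consistent, and it respects the identity rules; it is admissible if every rule instance with true premises has a true conclusion. Models are given by admissible valuations with Robinson semantics: a structure $M$ is named by constants of an expanded vocabulary $\tau_M\supseteq\tau_N$. Inferential $\omega$-logic adds, for any countable set $C$ of constants containing the distinguished set $\mathrm{Const}(\tau_N)$ and any formula $\phi(x,\bar d)$ with parameters from $C$: $I$-$\omega$-rule: from $\{\phi(c,\bar d):c\in\mathrm{Const}(\tau_N)\}$ infer $(\forall x)\phi(x,\bar d)$; $I$-$\forall E$: from $(\forall x)\phi(x,\bar d)$ infer $\phi(e,\bar d)$ for each $e\in C$; and the corresponding existential rules. -}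

module Defs where

open import Data.Nat using (ℕ; zero; suc)
open import Data.Fin using (Fin) renaming (zero to fz; suc to fs)
open import Data.Product using (Σ; _×_; _,_)
open import Data.Sum using (_⊎_)
open import Data.Empty using (⊥)
open import Relation.Nullary using (¬_)
open import Relation.Binary.PropositionalEquality using (_≡_)
open import Function.Definitions using (Injective; Surjective)

-- Syntax: the vocabulary τ_N = {0, S, +, ×} expanded by a set C of
-- constants.  Scoped de Bruijn indices: Term C n / Formula C n have
-- at most n free variables; a sentence is a Formula C 0.

data Term (C : Set) (n : ℕ) : Set where
  var  : Fin n → Term C n
  con  : C → Term C n
  zer  : Term C n
  sc   : Term C n → Term C n
  _⊕_  : Term C n → Term C n → Term C n
  _⊗_  : Term C n → Term C n → Term C n

data Formula (C : Set) : ℕ → Set where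
  _≐_  : ∀ {n} → Term C n → Term C n → Formula C n
  ⊥′   : ∀ {n} → Formula C n
  ¬′   : ∀ {n} → Formula C n → Formula C n
  _∧′_ : ∀ {n} → Formula C n → Formula C n → Formula C n
  _∨′_ : ∀ {n} → Formula C n → Formula C n → Formula C n
  _⇒′_ : ∀ {n} → Formula C n → Formula C n → Formula C n
  ∀′   : ∀ {n} → Formula C (suc n) → Formula C n
  ∃′   : ∀ {n} → Formula C (suc n) → Formula C n

Sentence : Set → Set
Sentence C = Formula C 0

renT : ∀ {C m n} → (Fin m → Fin n) → Term C m → Term C n
renT r (var i) = var (r i)
renT r (con c) = con c
renT r zer = zer
renT r (sc t) = sc (renT r t)
renT r (t ⊕ u) = renT r t ⊕ renT r u
renT r (t ⊗ u) = renT r t ⊗ renT r u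

subT : ∀ {C m n} → (Fin m → Term C n) → Term C m → Term C n
subT σ (var i) = σ i
subT σ (con c) = con c
subT σ zer = zer
subT σ (sc t) = sc (subT σ t)
subT σ (t ⊕ u) = subT σ t ⊕ subT σ u
subT σ (t ⊗ u) = subT σ t ⊗ subT σ u

liftS : ∀ {C m n} → (Fin m → Term C n) → Fin (suc m) → Term C (suc n)
liftS σ fz = var fz
liftS σ (fs i) = renT fs (σ i)

subF : ∀ {C m n} → (Fin m → Term C n) → Formula C m → Formula C n
subF σ (t ≐ u) = subT σ t ≐ subT σ u
subF σ ⊥′ = ⊥′
subF σ (¬′ φ) = ¬′ (subF σ φ)
subF σ (φ ∧′ ψ) = subF σ φ ∧′ subF σ ψ
subF σ (φ ∨′ ψ) = subF σ φ ∨′ subF σ ψ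
subF σ (φ ⇒′ ψ) = subF σ φ ⇒′ subF σ ψ
subF σ (∀′ φ) = ∀′ (subF (liftS σ) φ)
subF σ (∃′ φ) = ∃′ (subF (liftS σ) φ)

-- φ(e): instantiate the single free variable x of φ(x, d̄) (parameters
-- d̄ ∈ C occur as constants) by the constant e.
inst : ∀ {C} → Formula C 1 → C → Sentence C
inst φ e = subF (λ _ → con e) φ

record Structure : Set₁ where
  field
    Carrier : Set
    z       : Carrier
    s       : Carrier → Carrier
    add     : Carrier → Carrier → Carrier
    mul     : Carrier → Carrier → Carrier

numeral : (M : Structure) → ℕ → Structure.Carrier M
numeral M zero = Structure.z M
numeral M (suc n) = Structure.s M (numeral M n)

record Embedding (M : Structure) (ι : ℕ → Structure.Carrier M) : Set where
  open Structure M
  field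
    inj     : Injective _≡_ _≡_ ι
    pres-z  : ι 0 ≡ z
    pres-s  : ∀ n → ι (suc n) ≡ s (ι n)
    pres-add : ∀ m n → ι (m Data.Nat.+ n) ≡ add (ι m) (ι n)
    pres-mul : ∀ m n → ι (m Data.Nat.* n) ≡ mul (ι m) (ι n)

record Isomorphism (M₁ M₂ : Structure) : Set where
  private
    module A = Structure M₁
    module B = Structure M₂
  field
    to       : A.Carrier → B.Carrier
    from     : B.Carrier → A.Carrier
    from-to  : ∀ a → from (to a) ≡ a
    to-from  : ∀ b → to (from b) ≡ b
    pres-z   : to A.z ≡ B.z
    pres-s   : ∀ a → to (A.s a) ≡ B.s (to a)
    pres-add : ∀ a b → to (A.add a b) ≡ B.add (to a) (to b)
    pres-mul : ∀ a b → to (A.mul a b) ≡ B.mul (to a) (to b)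

-- Robinson semantics: M is named by the constants C via ν; quantifiers
-- range over the constants.  This gives the valuation v_M on sentences
-- (truth values are propositions, i.e. types).

module Robinson {C : Set} (M : Structure) (ν : C → Structure.Carrier M) where
  open Structure M

  ext : ∀ {n} → Carrier → (Fin n → Carrier) → Fin (suc n) → Carrier
  ext a ρ fz = a
  ext a ρ (fs i) = ρ i

  evalT : ∀ {n} → (Fin n → Carrier) → Term C n → Carrier
  evalT ρ (var i) = ρ i
  evalT ρ (con c) = ν c
  evalT ρ zer = z
  evalT ρ (sc t) = s (evalT ρ t)
  evalT ρ (t ⊕ u) = add (evalT ρ t) (evalT ρ u)
  evalT ρ (t ⊗ u) = mul (evalT ρ t) (evalT ρ u)

  Sat : ∀ {n} → Formula C n → (Fin n → Carrier) → Set
  Sat (t ≐ u) ρ = evalT ρ t ≡ evalT ρ u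
  Sat ⊥′ ρ = ⊥
  Sat (¬′ φ) ρ = ¬ Sat φ ρ
  Sat (φ ∧′ ψ) ρ = Sat φ ρ × Sat ψ ρ
  Sat (φ ∨′ ψ) ρ = Sat φ ρ ⊎ Sat ψ ρ
  Sat (φ ⇒′ ψ) ρ = Sat φ ρ → Sat ψ ρ
  Sat (∀′ φ) ρ = (c : C) → Sat φ (ext (ν c) ρ)
  Sat (∃′ φ) ρ = Σ C (λ c → Sat φ (ext (ν c) ρ))

  v : Sentence C → Set
  v φ = Sat φ (λ ())

-- Admissibility of a valuation v for the quantifier rules of
-- inferential ω-logic, over the constant set C with distinguished
-- constants Const(τ_N) = { num n : n ∈ ℕ }.

record AdmissibleQuant {C : Set} (num : ℕ → C) (v : Sentence C → Set) : Set where
  field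
    I-ω   : ∀ (φ : Formula C 1) → (∀ n → v (inst φ (num n))) → v (∀′ φ)
    I-∀E  : ∀ (φ : Formula C 1) (e : C) → v (∀′ φ) → v (inst φ e)
    I-∃I  : ∀ (φ : Formula C 1) (e : C) → v (inst φ e) → v (∃′ φ)
    I-∃E  : ∀ (φ : Formula C 1) (ψ : Sentence C) →
            v (∃′ φ) → (∀ n → v (inst φ (num n) ⇒′ ψ)) → v ψ

-- The axioms of Robinson's Q as sentences (x = var 0 innermost binder)

private
  x0 : ∀ {C n} → Term C (suc n)
  x0 = var fz
  x1 : ∀ {C n} → Term C (suc (suc n))
  x1 = var (fs fz)

Q-axioms : (C : Set) → Sentence C → Set
Q-axioms C φ =
    (φ ≡ ∀′ (¬′ (sc x0 ≐ zer)))
  ⊎ (φ ≡ ∀′ (∀′ ((sc x1 ≐ sc x0) ⇒′ (x1 ≐ x0))))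
  ⊎ (φ ≡ ∀′ (¬′ (x0 ≐ zer) ⇒′ ∃′ (x1 ≐ sc x0)))
  ⊎ (φ ≡ ∀′ ((x0 ⊕ zer) ≐ x0))
  ⊎ (φ ≡ ∀′ (∀′ ((x1 ⊕ sc x0) ≐ sc (x1 ⊕ x0))))
  ⊎ (φ ≡ ∀′ ((x0 ⊗ zer) ≐ zer))
  ⊎ (φ ≡ ∀′ (∀′ ((x1 ⊗ sc x0) ≐ ((x1 ⊗ x0) ⊕ x1))))

record QωModel : Set₁ where
  field
    M         : Structure
    C         : Set
    countable : Σ (C → ℕ) (λ f → Injective _≡_ _≡_ f)
    num       : ℕ → C
    num-inj   : Injective _≡_ _≡_ num
    ν         : C → Structure.Carrier M
    ν-onto    : Surjective _≡_ _≡_ ν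
    ν-num     : ∀ n → ν (num n) ≡ numeral M n
  open Robinson M ν public
  field
    Q-true     : ∀ φ → Q-axioms C φ → v φ
    admissible : AdmissibleQuant num v

{-# OPTIONS --safe #-}
module Submission where

-- Under Robinson semantics every element of a model of Q^ω is named by a
-- constant c.  If its value were different from every numeral, then
-- ¬ (x ≐ c) would hold at every numeral, so the ω-rule would make
-- ∀x ¬ (x ≐ c) true, whose instance at c itself is false.  Hence no element
-- is non-standard, which already excludes proper extensions of ℕ.
-- Classically every element is therefore a numeral; since the axioms of Q
-- make numerals injective and compute + and × on them, numeral M is an
-- isomorphism ℕ ≅ M, and any two models are isomorphic through ℕ.

open import Defs
open import Data.Nat using (ℕ; zero; suc; _+_; _*_)
open import Data.Nat.Properties using (+-suc; +-identityʳ; *-suc; *-zeroʳ; +-comm)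
open import Data.Product using (Σ; ∃; _×_; _,_; proj₁; proj₂)
open import Data.Sum using (inj₁; inj₂)
open import Data.Empty using (⊥-elim)
open import Data.Fin using () renaming (zero to fz)
open import Function using (_∘_)
open import Relation.Nullary using (¬_)
open import Relation.Binary.PropositionalEquality
open import Axiom.ExcludedMiddle using (ExcludedMiddle)
open import Axiom.DoubleNegationElimination using (em⇒dne)
open import Level using (0ℓ)

ℕ-structure : Structure
ℕ-structure = record { Carrier = ℕ ; z = zero ; s = suc ; add = _+_ ; mul = _*_ }

Isomorphism-sym : ∀ {M₁ M₂} → Isomorphism M₁ M₂ → Isomorphism M₂ M₁
Isomorphism-sym {M₁} {M₂} f = record
  { to = from ; from = to ; from-to = to-from ; to-from = from-to
  ; pres-z   = from-unique pres-z
  ; pres-s   = λ b → from-unique (trans (pres-s (from b)) (cong B.s (to-from b)))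
  ; pres-add = λ a b → from-unique (trans (pres-add _ _) (cong₂ B.add (to-from a) (to-from b)))
  ; pres-mul = λ a b → from-unique (trans (pres-mul _ _) (cong₂ B.mul (to-from a) (to-from b)))
  }
  where
    open Isomorphism f
    module A = Structure M₁
    module B = Structure M₂

    from-unique : ∀ {a b} → to a ≡ b → from b ≡ a
    from-unique {a} refl = from-to a

Isomorphism-trans : ∀ {M₁ M₂ M₃} → Isomorphism M₁ M₂ → Isomorphism M₂ M₃ → Isomorphism M₁ M₃
Isomorphism-trans f g = record
  { to = G.to ∘ F.to ; from = F.from ∘ G.from
  ; from-to  = λ a → trans (cong F.from (G.from-to (F.to a))) (F.from-to a)
  ; to-from  = λ c → trans (cong G.to (F.to-from (G.from c))) (G.to-from c)
  ; pres-z   = trans (cong G.to F.pres-z) G.pres-z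
  ; pres-s   = λ a → trans (cong G.to (F.pres-s a)) (G.pres-s _)
  ; pres-add = λ a b → trans (cong G.to (F.pres-add a b)) (G.pres-add _ _)
  ; pres-mul = λ a b → trans (cong G.to (F.pres-mul a b)) (G.pres-mul _ _)
  }
  where
    module F = Isomorphism f
    module G = Isomorphism g

embedding≗numeral : ∀ {M ι} → Embedding M ι → ι ≗ numeral M
embedding≗numeral e zero    = Embedding.pres-z e
embedding≗numeral {M} e (suc n) =
  trans (Embedding.pres-s e n) (cong (Structure.s M) (embedding≗numeral e n))

-- The axioms of Q except x ≠ 0 → ∃y (x = S y), which the argument never uses.
record IsRobinson (M : Structure) : Set where
  open Structure M
  field
    s≢z         : ∀ a → ¬ s a ≡ z
    s-injective : ∀ a b → s a ≡ s b → a ≡ b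
    add-zeroʳ   : ∀ a → add a z ≡ a
    add-sucʳ    : ∀ a b → add a (s b) ≡ s (add a b)
    mul-zeroʳ   : ∀ a → mul a z ≡ z
    mul-sucʳ    : ∀ a b → mul a (s b) ≡ add (mul a b) a

module IsRobinsonProperties {M : Structure} (isRobinson : IsRobinson M) where
  open Structure M
  open IsRobinson isRobinson
  open ≡-Reasoning

  numeral-injective : ∀ m n → numeral M m ≡ numeral M n → m ≡ n
  numeral-injective zero    zero    _  = refl
  numeral-injective zero    (suc n) eq = ⊥-elim (s≢z _ (sym eq))
  numeral-injective (suc m) zero    eq = ⊥-elim (s≢z _ eq)
  numeral-injective (suc m) (suc n) eq =
    cong suc (numeral-injective m n (s-injective _ _ eq))

  numeral-+ : ∀ m n → numeral M (m + n) ≡ add (numeral M m) (numeral M n)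
  numeral-+ m zero = begin
    numeral M (m + 0)     ≡⟨ cong (numeral M) (+-identityʳ m) ⟩
    numeral M m           ≡⟨ add-zeroʳ _ ⟨
    add (numeral M m) z   ∎
  numeral-+ m (suc n) = begin
    numeral M (m + suc n)                  ≡⟨ cong (numeral M) (+-suc m n) ⟩
    s (numeral M (m + n))                  ≡⟨ cong s (numeral-+ m n) ⟩
    s (add (numeral M m) (numeral M n))    ≡⟨ add-sucʳ _ _ ⟨
    add (numeral M m) (numeral M (suc n))  ∎

  numeral-* : ∀ m n → numeral M (m * n) ≡ mul (numeral M m) (numeral M n)
  numeral-* m zero = begin
    numeral M (m * 0)     ≡⟨ cong (numeral M) (*-zeroʳ m) ⟩
    z                     ≡⟨ mul-zeroʳ _ ⟨
    mul (numeral M m) z   ∎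
  numeral-* m (suc n) = begin
    numeral M (m * suc n)                               ≡⟨ cong (numeral M) (trans (*-suc m n) (+-comm m (m * n))) ⟩
    numeral M (m * n + m)                               ≡⟨ numeral-+ (m * n) m ⟩
    add (numeral M (m * n)) (numeral M m)               ≡⟨ cong (λ a → add a (numeral M m)) (numeral-* m n) ⟩
    add (mul (numeral M m) (numeral M n)) (numeral M m) ≡⟨ mul-sucʳ _ _ ⟨
    mul (numeral M m) (numeral M (suc n))               ∎

  numeral-isomorphism : (∀ a → ∃ λ n → numeral M n ≡ a) → Isomorphism ℕ-structure M
  numeral-isomorphism numeral-onto = record
    { to = numeral M ; from = proj₁ ∘ numeral-onto
    ; from-to  = λ n → numeral-injective _ n (proj₂ (numeral-onto (numeral M n)))
    ; to-from  = proj₂ ∘ numeral-onto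
    ; pres-z   = refl
    ; pres-s   = λ _ → refl
    ; pres-add = numeral-+
    ; pres-mul = numeral-*
    }

module QωModelProperties (𝓜 : QωModel) where
  open QωModel 𝓜
  open Structure M

  ν-elim : {P : Carrier → Set} → (∀ c → P (ν c)) → ∀ a → P a
  ν-elim {P} P-ν a = subst P (proj₂ (ν-onto a) refl) (P-ν (proj₁ (ν-onto a)))

  isRobinson : IsRobinson M
  isRobinson = record
    { s≢z         = ν-elim (Q-true _ (inj₁ refl))
    ; s-injective = ν-elim λ c → ν-elim (Q-true _ (inj₂ (inj₁ refl)) c)
    ; add-zeroʳ   = ν-elim (Q-true _ (inj₂ (inj₂ (inj₂ (inj₁ refl)))))
    ; add-sucʳ    = ν-elim λ c → ν-elim (Q-true _ (inj₂ (inj₂ (inj₂ (inj₂ (inj₁ refl))))) c)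
    ; mul-zeroʳ   = ν-elim (Q-true _ (inj₂ (inj₂ (inj₂ (inj₂ (inj₂ (inj₁ refl)))))))
    ; mul-sucʳ    = ν-elim λ c → ν-elim (Q-true _ (inj₂ (inj₂ (inj₂ (inj₂ (inj₂ (inj₂ refl)))))) c)
    }

  no-nonstandard-element : ∀ a → ¬ (∀ n → ¬ numeral M n ≡ a)
  no-nonstandard-element = ν-elim λ c nonstandard →
    AdmissibleQuant.I-ω admissible (¬′ (var fz ≐ con c))
      (λ n → nonstandard n ∘ trans (sym (ν-num n)))
      c refl

  numeral-surjective : ExcludedMiddle 0ℓ → ∀ a → ∃ λ n → numeral M n ≡ a
  numeral-surjective lem a =
    em⇒dne lem λ not-numeral → no-nonstandard-element a (λ n eq → not-numeral (n , eq))

  ℕ≅M : ExcludedMiddle 0ℓ → Isomorphism ℕ-structure M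
  ℕ≅M lem = IsRobinsonProperties.numeral-isomorphism isRobinson (numeral-surjective lem)

standard-model-has-no-proper-extension :
  (𝓜 : QωModel) (ι : ℕ → Structure.Carrier (QωModel.M 𝓜)) →
  Embedding (QωModel.M 𝓜) ι →
  ¬ Σ (Structure.Carrier (QωModel.M 𝓜)) (λ m → (n : ℕ) → ¬ ι n ≡ m)
standard-model-has-no-proper-extension 𝓜 ι e (m , outside-ι) =
  QωModelProperties.no-nonstandard-element 𝓜 m
    (λ n eq → outside-ι n (trans (embedding≗numeral e n) eq))

Qω-categorical : ExcludedMiddle 0ℓ →
  (𝓜₁ 𝓜₂ : QωModel) → Isomorphism (QωModel.M 𝓜₁) (QωModel.M 𝓜₂)
Qω-categorical lem 𝓜₁ 𝓜₂ =
  Isomorphism-trans (Isomorphism-sym (QωModelProperties.ℕ≅M 𝓜₁ lem)) (QωModelProperties.ℕ≅M 𝓜₂ lem)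

theorem4p1p9 :
    ((𝓜 : QωModel) (ι : ℕ → Structure.Carrier (QωModel.M 𝓜)) →
       Embedding (QωModel.M 𝓜) ι →
       ¬ Σ (Structure.Carrier (QωModel.M 𝓜)) (λ m → (n : ℕ) → ¬ ι n ≡ m))
    × (ExcludedMiddle 0ℓ →
       (𝓜₁ 𝓜₂ : QωModel) → Isomorphism (QωModel.M 𝓜₁) (QωModel.M 𝓜₂))
theorem4p1p9 = standard-model-has-no-proper-extension , Qω-categorical
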